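{- Let $p$ be an odd prime. Let $\mu$ denote the number of integers $j$ with $1\le j<\frac{p}{2}$ such that the inverse $j^{ -1}$ of $j$ modulo $p$, taken as the unique representative in $\{1,2,\dots,p-1\}$, also satisfies $j^{ -1}<\frac{p}{2}$. (1) If $p\equiv 3\pmod 4$, then $(p-1)!!\equiv (-1)^{\frac{\mu+1}{2}}\pmod p$. (2) If $p\equiv 1\pmod 4$, then $(p-1)!!\equiv (-1)^{\frac{\mu+1}{2}}\, i_p\pmod p$, where $i_p$ is the unique natural number less than $\frac{p}{2}$ with $i_p^2\equiv -1\pmod p$.
   Context: For a natural number $n$, the double factorial $n!!$ is the product of the natural numbers less than or equal to $n$ that have the same parity as $n$. -}

module Defs where

open import Data.Nat using (ℕ; zero; suc; _+_; _*_; _<_; _%_; _/_; _≟_; _<?_; NonZero)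
open import Data.List using (List; length; filter; upTo; map)
open import Data.Integer using (ℤ; +_; _-_)
open import Data.Integer.Divisibility using (_∣_)
open import Relation.Nullary using (yes; no)

_!! : ℕ → ℕ
zero !! = 1
suc zero !! = 1
suc (suc n) !! = suc (suc n) * (n !!)

_≡_[mod_] : ℤ → ℤ → ℕ → Set
a ≡ b [mod m ] = (+ m) ∣ (a - b)

invFrom : (p : ℕ) .{{_ : NonZero p}} → ℕ → ℕ → ℕ → ℕ
invFrom p j k zero = 0
invFrom p j k (suc fuel) with (j * k) % p ≟ 1
... | yes _ = k
... | no _ = invFrom p j (suc k) fuel

-- The inverse of j modulo p, as the representative in {1, ..., p-1}
-- (scan k = 1, ..., p-1). For p prime and p ∤ j this is the unique inverse.
invMod : (p : ℕ) .{{_ : NonZero p}} → ℕ → ℕ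
invMod p j = invFrom p j 1 (p Data.Nat.∸ 1)

-- μ(p) = #{ j : 1 ≤ j < p/2 , j⁻¹ mod p < p/2 }.
-- The j with 1 ≤ j < p/2 are j = 1, ..., ⌊p/2⌋ for p odd (2j < p).
mu : (p : ℕ) .{{_ : NonZero p}} → ℕ
mu p = length (filter (λ j → 2 * invMod p (suc j) <? p)
                      (upTo (p / 2)))

{-# OPTIONS --safe #-}
-- Put h = (p - 1)/2. An even factor 2j > h of (p - 1)!! is congruent to -(p - 2j), and these p - 2j are
-- exactly the odd numbers up to h, so (p - 1)!! ≡ (-1)^⌈h/2⌉ h! (mod p).
-- For h!, send x ∈ {1, …, h} to σ x, the one of ±x⁻¹ lying in {1, …, h}. Then σ is an involution,
-- x · σ x ≡ ±1 with sign + exactly when x⁻¹ < p/2, and x and σ x have the same sign. The fixed points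
-- of σ are 1 and the square root i_p of -1 when it exists; the rest of {1, …, h} splits into P₊
-- positive and P₋ negative two-cycles. Counting gives h = 1 + F + 2(P₊ + P₋) with F ∈ {0, 1},
-- μ = 1 + 2P₊ and h! ≡ i_p^F (-1)^P₋, hence (p - 1)!! ≡ (-1)^(1 + P₊) i_p^F = (-1)^((μ+1)/2) i_p^F.
-- When p ≡ 3 (mod 4), h is odd, which forces F = 0.
module Submission where

open import Algebra.Bundles using (CommutativeMonoid)
open import Data.Empty using (⊥-elim)
open import Data.Integer using (ℤ; +_; -_; ∣_∣)
import Data.Integer.Properties as ℤP
open import Data.Integer.Divisibility.Signed using (_∣_; divides; ∣m∣n⇒∣m+n; ∣m⇒∣-m; ∣n⇒∣m*n; ∣m⇒∣m*n; ∣⇒∣ᵤ; ∣ᵤ⇒∣)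
open import Data.Integer.Tactic.RingSolver using (solve-∀)
open import Data.List using (List; []; _∷_; _∷ʳ_; filter; length; map; applyUpTo; upTo)
open import Data.List.Membership.Propositional using (_∈_)
open import Data.List.Membership.Propositional.Properties using (∈-filter⁺; ∈-filter⁻; ∈-applyUpTo⁺; ∈-applyUpTo⁻)
open import Data.List.Properties using (filter-accept; filter-reject; filter-all; length-filter; length-applyUpTo; applyUpTo-∷ʳ; map-applyUpTo)
open import Data.List.Relation.Unary.All as All using (All)
open import Data.List.Relation.Unary.Any using (here; there)
open import Data.List.Relation.Unary.AllPairs using (_∷_)
open import Data.List.Relation.Unary.Unique.Propositional using (Unique)
import Data.List.Relation.Unary.Unique.Propositional.Properties as Unique
open import Data.Nat as ℕ using (ℕ; zero; suc; NonZero; _≤_; _<_; z≤n; s≤s; _≟_; _<?_; _∸_; _!)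
open import Data.Nat.DivMod using (_%_; m*n%n≡0)
import Data.Nat.Divisibility as ℕ∣
open import Data.Nat.Primality using (Prime; euclidsLemma; prime⇒nonTrivial)
import Data.Nat.Properties as ℕP
open import Data.Nat.Tactic.RingSolver using () renaming (solve-∀ to ℕ-solve-∀)
open import Data.Product using (∃; _×_; _,_; proj₁; proj₂; uncurry)
open import Data.Sum as Sum using (_⊎_; inj₁; inj₂)
open import Function using (_∘_)
open import Level using (0ℓ)
open import Relation.Binary.Bundles using (Setoid)
open import Relation.Binary.Definitions using (tri<; tri≈; tri>)
open import Relation.Binary.PropositionalEquality using (_≡_; _≢_; refl; sym; trans; cong; cong₂; subst; subst₂; module ≡-Reasoning)
open import Relation.Binary.Structures using (IsEquivalence)
open import Relation.Nullary using (Dec; ¬_; yes; no; ¬?)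
open import Defs

double≡+ : ∀ x → 2 ℕ.* x ≡ x ℕ.+ x
double≡+ x = cong (x ℕ.+_) (ℕP.+-identityʳ x)

double<⇒< : ∀ {x n} → 2 ℕ.* x < n → x < n
double<⇒< {x} = ℕP.≤-<-trans (ℕP.m≤m+n x (x ℕ.+ 0))

+<-of-doubles< : ∀ {x y n} → 2 ℕ.* x < n → 2 ℕ.* y < n → x ℕ.+ y < n
+<-of-doubles< {x} {y} 2x<n 2y<n with ℕP.≤-total x y
... | inj₁ x≤y = ℕP.≤-<-trans (ℕP.≤-trans (ℕP.+-monoˡ-≤ y x≤y) (ℕP.≤-reflexive (sym (double≡+ y)))) 2y<n
... | inj₂ y≤x = ℕP.≤-<-trans (ℕP.≤-trans (ℕP.+-monoʳ-≤ x y≤x) (ℕP.≤-reflexive (sym (double≡+ x)))) 2x<n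

odd≢double : ∀ {n} → n % 2 ≡ 1 → ∀ r → n ≢ 2 ℕ.* r
odd≢double {n} n%2≡1 r refl with () ← trans (sym n%2≡1) (trans (cong (_% 2) (ℕP.*-comm 2 r)) (m*n%n≡0 r 2))

suc+suc≡ : ∀ a → suc a ℕ.+ suc a ≡ suc (suc (a ℕ.+ a))
suc+suc≡ a = cong suc (ℕP.+-suc a a)

suc-!! : ∀ m → suc m !! ≡ suc m ℕ.* (m ∸ 1) !!
suc-!! zero = refl
suc-!! (suc m) = refl

!!*!!≡! : ∀ n → n !! ℕ.* (n ∸ 1) !! ≡ n !
!!*!!≡! zero = refl
!!*!!≡! (suc n) = begin
  suc n !! ℕ.* n !!                ≡⟨ cong (ℕ._* n !!) (suc-!! n) ⟩
  (suc n ℕ.* (n ∸ 1) !!) ℕ.* n !!  ≡⟨ ℕP.*-assoc (suc n) ((n ∸ 1) !!) (n !!) ⟩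
  suc n ℕ.* ((n ∸ 1) !! ℕ.* n !!)  ≡⟨ cong (suc n ℕ.*_) (ℕP.*-comm ((n ∸ 1) !!) (n !!)) ⟩
  suc n ℕ.* (n !! ℕ.* (n ∸ 1) !!)  ≡⟨ cong (suc n ℕ.*_) (!!*!!≡! n) ⟩
  suc n ℕ.* n !                    ∎
  where open ≡-Reasoning

!!*odd!!≡! : ∀ a b → b ≡ a ⊎ b ≡ suc a → (a ℕ.+ a) !! ℕ.* ((b ℕ.+ b) ∸ 1) !! ≡ (a ℕ.+ b) !
!!*odd!!≡! a _ (inj₁ refl) = !!*!!≡! (a ℕ.+ a)
!!*odd!!≡! a _ (inj₂ refl) = begin
  (a ℕ.+ a) !! ℕ.* ((suc a ℕ.+ suc a) ∸ 1) !!  ≡⟨ cong (λ t → (a ℕ.+ a) !! ℕ.* (t ∸ 1) !!) (suc+suc≡ a) ⟩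
  (a ℕ.+ a) !! ℕ.* suc (a ℕ.+ a) !!            ≡⟨ ℕP.*-comm ((a ℕ.+ a) !!) (suc (a ℕ.+ a) !!) ⟩
  suc (a ℕ.+ a) !! ℕ.* (a ℕ.+ a) !!            ≡⟨ !!*!!≡! (suc (a ℕ.+ a)) ⟩
  suc (a ℕ.+ a) !                             ≡⟨ cong _! (ℕP.+-suc a a) ⟨
  (a ℕ.+ suc a) !                             ∎
  where open ≡-Reasoning

remove : ℕ → List ℕ → List ℕ
remove z = filter (λ y → ¬? (y ≟ z))

remove-head : ∀ {y ys} → All (y ≢_) ys → remove y (y ∷ ys) ≡ ys
remove-head {y} {ys} y∉ys = trans (filter-reject (λ w → ¬? (w ≟ y)) (λ y≢y → y≢y refl))
  (filter-all (λ w → ¬? (w ≟ y)) (All.map (λ y≢w w≡y → y≢w (sym w≡y)) y∉ys))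

module Orbits (σ : ℕ → ℕ) where
  data Position (x : ℕ) : Set where
    fixed : σ x ≡ x → Position x
    lower : x < σ x → Position x
    upper : σ x < x → Position x

  position : ∀ x → Position x
  position x with ℕP.<-cmp x (σ x)
  ... | tri< x<σx _ _ = lower x<σx
  ... | tri≈ _ x≡σx _ = fixed (sym x≡σx)
  ... | tri> _ _ σx<x = upper σx<x

  byPosition : ∀ {a} {A : Set a} → ℕ → A → A → A → A
  byPosition x f l u with position x
  ... | fixed _ = f
  ... | lower _ = l
  ... | upper _ = u

  Closed Involutive : List ℕ → Set
  Closed xs = ∀ {x} → x ∈ xs → σ x ∈ xs
  Involutive xs = ∀ {x} → x ∈ xs → σ (σ x) ≡ x

  record InvolutionOn (xs : List ℕ) : Set where
    field
      unique : Unique xs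
      closed : Closed xs
      involutive : Involutive xs

  σ-∈-tail : ∀ {x xs} → Closed (x ∷ xs) → σ x ≢ x → σ x ∈ xs
  σ-∈-tail closed σx≢x with closed (here refl)
  ... | here σx≡x = ⊥-elim (σx≢x σx≡x)
  ... | there σx∈xs = σx∈xs

  closed-tail : ∀ {x xs} → Unique (x ∷ xs) → Involutive (x ∷ xs) → Closed (x ∷ xs) → σ x ≡ x → Closed xs
  closed-tail {x} (x∉xs ∷ _) involutive closed σx≡x {y} y∈xs with closed (there y∈xs)
  ... | there σy∈xs = σy∈xs
  ... | here σy≡x = ⊥-elim (All.lookup x∉xs y∈xs (begin
    x         ≡⟨ sym σx≡x ⟩
    σ x       ≡⟨ cong σ σy≡x ⟨
    σ (σ y)   ≡⟨ involutive (there y∈xs) ⟩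
    y         ∎))
    where open ≡-Reasoning

  closed-remove : ∀ {x xs} → Unique (x ∷ xs) → Involutive (x ∷ xs) → Closed (x ∷ xs) → Closed (remove (σ x) xs)
  closed-remove {x} {xs} (x∉xs ∷ _) involutive closed y∈rest
    with y∈xs , y≢σx ← ∈-filter⁻ (λ w → ¬? (w ≟ σ x)) {xs = xs} y∈rest
    with closed (there y∈xs)
  ... | here σy≡x = ⊥-elim (y≢σx (trans (sym (involutive (there y∈xs))) (cong σ σy≡x)))
  ... | there σy∈xs = ∈-filter⁺ (λ w → ¬? (w ≟ σ x)) σy∈xs λ σy≡σx →
    All.lookup x∉xs y∈xs (trans (sym (involutive (here refl)))
      (trans (cong σ (sym σy≡σx)) (involutive (there y∈xs))))

module BigOperator {c ℓ} (M : CommutativeMonoid c ℓ) where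
  open CommutativeMonoid M renaming (Carrier to A; refl to ≈-refl; sym to ≈-sym; trans to ≈-trans; reflexive to ≈-reflexive)
  open import Algebra.Properties.CommutativeSemigroup commutativeSemigroup using (interchange; x∙yz≈y∙xz)
  open import Relation.Binary.Reasoning.Setoid setoid

  foldMap : (ℕ → A) → List ℕ → A
  foldMap f [] = ε
  foldMap f (x ∷ xs) = f x ∙ foldMap f xs

  foldMap-cong : ∀ {f g} xs → (∀ {x} → x ∈ xs → f x ≈ g x) → foldMap f xs ≈ foldMap g xs
  foldMap-cong [] f≈g = ≈-refl
  foldMap-cong (x ∷ xs) f≈g = ∙-cong (f≈g (here refl)) (foldMap-cong xs (f≈g ∘ there))

  foldMap-ε : ∀ {f} xs → (∀ {x} → x ∈ xs → f x ≈ ε) → foldMap f xs ≈ ε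
  foldMap-ε [] f≈ε = ≈-refl
  foldMap-ε (x ∷ xs) f≈ε = ≈-trans (∙-cong (f≈ε (here refl)) (foldMap-ε xs (f≈ε ∘ there))) (identityˡ ε)

  foldMap-∙ : ∀ f g xs → foldMap (λ x → f x ∙ g x) xs ≈ foldMap f xs ∙ foldMap g xs
  foldMap-∙ f g [] = ≈-sym (identityˡ ε)
  foldMap-∙ f g (x ∷ xs) = begin
    (f x ∙ g x) ∙ foldMap (λ x → f x ∙ g x) xs ≈⟨ ∙-congˡ (foldMap-∙ f g xs) ⟩
    (f x ∙ g x) ∙ (foldMap f xs ∙ foldMap g xs) ≈⟨ interchange (f x) (g x) _ _ ⟩
    (f x ∙ foldMap f xs) ∙ (g x ∙ foldMap g xs) ∎

  foldMap-remove : ∀ f {xs z} → Unique xs → z ∈ xs → foldMap f xs ≈ f z ∙ foldMap f (remove z xs)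
  foldMap-remove f (y∉ys ∷ _) (here refl) = ∙-congˡ (≈-reflexive (cong (foldMap f) (sym (remove-head y∉ys))))
  foldMap-remove f {y ∷ ys} {z} (y∉ys ∷ unique) (there z∈ys) = begin
    f y ∙ foldMap f ys                      ≈⟨ ∙-congˡ (foldMap-remove f unique z∈ys) ⟩
    f y ∙ (f z ∙ foldMap f (remove z ys))   ≈⟨ x∙yz≈y∙xz (f y) (f z) _ ⟩
    f z ∙ (f y ∙ foldMap f (remove z ys))   ≡⟨ cong (λ ws → f z ∙ foldMap f ws) (sym (filter-accept (λ w → ¬? (w ≟ z)) (All.lookup y∉ys z∈ys))) ⟩
    f z ∙ foldMap f (remove z (y ∷ ys))     ∎

  foldMap-single : ∀ {f xs z} → Unique xs → z ∈ xs → (∀ {x} → x ∈ xs → x ≢ z → f x ≈ ε) → foldMap f xs ≈ f z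
  foldMap-single {f} {xs} {z} unique z∈xs others≈ε = begin
    foldMap f xs                   ≈⟨ foldMap-remove f unique z∈xs ⟩
    f z ∙ foldMap f (remove z xs)  ≈⟨ ∙-congˡ (foldMap-ε (remove z xs) (λ m → uncurry others≈ε (∈-filter⁻ (λ w → ¬? (w ≟ z)) m))) ⟩
    f z ∙ ε                        ≈⟨ identityʳ (f z) ⟩
    f z                            ∎

  foldMap-map : ∀ f g xs → foldMap f (map g xs) ≈ foldMap (f ∘ g) xs
  foldMap-map f g [] = ≈-refl
  foldMap-map f g (x ∷ xs) = ∙-congˡ (foldMap-map f g xs)

  foldMap-∷ʳ : ∀ f xs y → foldMap f (xs ∷ʳ y) ≈ f y ∙ foldMap f xs
  foldMap-∷ʳ f [] y = ≈-trans (identityʳ (f y)) (≈-sym (identityʳ (f y)))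
  foldMap-∷ʳ f (x ∷ xs) y = ≈-trans (∙-congˡ (foldMap-∷ʳ f xs y)) (x∙yz≈y∙xz (f x) (f y) (foldMap f xs))

  module _ (σ : ℕ → ℕ) where
    open Orbits σ

    -- A two-element orbit {x, σ x} is accounted for at its smaller element.
    fixedPart lowerPart : (ℕ → A) → ℕ → A
    fixedPart a x = byPosition x (a x) ε ε
    lowerPart a x = byPosition x ε (a x) ε

    fixedPart-fixed : ∀ f {x} → σ x ≡ x → fixedPart f x ≈ f x
    fixedPart-fixed f {x} σx≡x with position x
    ... | fixed _ = ≈-refl
    ... | lower x<σx = ⊥-elim (ℕP.<-irrefl (sym σx≡x) x<σx)
    ... | upper σx<x = ⊥-elim (ℕP.<-irrefl σx≡x σx<x)

    fixedPart-ε : ∀ f {x} → (σ x ≡ x → f x ≈ ε) → fixedPart f x ≈ ε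
    fixedPart-ε f {x} fx≈ε with position x
    ... | fixed σx≡x = fx≈ε σx≡x
    ... | lower _ = ≈-refl
    ... | upper _ = ≈-refl

    lowerPart-cong : ∀ f g {x} → f x ≈ g x → lowerPart f x ≈ lowerPart g x
    lowerPart-cong f g {x} fx≈gx with position x
    ... | fixed _ = ≈-refl
    ... | lower _ = fx≈gx
    ... | upper _ = ≈-refl

    lowerPart-∙ : ∀ f g x → lowerPart (λ y → f y ∙ g y) x ≈ lowerPart f x ∙ lowerPart g x
    lowerPart-∙ f g x with position x
    ... | fixed _ = ≈-sym (identityˡ ε)
    ... | lower _ = ≈-refl
    ... | upper _ = ≈-sym (identityˡ ε)

    orbitPart : (ℕ → A) → ℕ → A
    orbitPart a x = fixedPart a x ∙ lowerPart (λ y → a y ∙ a (σ y)) x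

    orbitPart-fixed : ∀ a {x} → σ x ≡ x → orbitPart a x ≈ a x
    orbitPart-fixed a {x} σx≡x with position x
    ... | fixed _ = identityʳ (a x)
    ... | lower x<σx = ⊥-elim (ℕP.<-irrefl (sym σx≡x) x<σx)
    ... | upper σx<x = ⊥-elim (ℕP.<-irrefl σx≡x σx<x)

    orbitPart-pair : ∀ a {x} → σ (σ x) ≡ x → σ x ≢ x → orbitPart a x ∙ orbitPart a (σ x) ≈ a x ∙ a (σ x)
    orbitPart-pair a {x} σσx≡x σx≢x with position x | position (σ x)
    ... | fixed σx≡x | _ = ⊥-elim (σx≢x σx≡x)
    ... | _ | fixed σσx≡σx = ⊥-elim (σx≢x (trans (sym σσx≡σx) σσx≡x))
    ... | lower x<σx | lower σx<σσx = ⊥-elim (ℕP.<-asym x<σx (subst (σ x <_) σσx≡x σx<σσx))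
    ... | upper σx<x | upper σσx<σx = ⊥-elim (ℕP.<-asym σx<x (subst (_< σ x) σσx≡x σσx<σx))
    ... | lower _ | upper _ = begin
      (ε ∙ (a x ∙ a (σ x))) ∙ (ε ∙ ε) ≈⟨ ∙-cong (identityˡ _) (identityˡ ε) ⟩
      (a x ∙ a (σ x)) ∙ ε             ≈⟨ identityʳ _ ⟩
      a x ∙ a (σ x)                   ∎
    ... | upper _ | lower _ = begin
      (ε ∙ ε) ∙ (ε ∙ (a (σ x) ∙ a (σ (σ x)))) ≈⟨ ∙-cong (identityˡ ε) (identityˡ _) ⟩
      ε ∙ (a (σ x) ∙ a (σ (σ x)))             ≈⟨ identityˡ _ ⟩
      a (σ x) ∙ a (σ (σ x))                   ≈⟨ comm _ _ ⟩
      a (σ (σ x)) ∙ a (σ x)                   ≡⟨ cong (λ y → a y ∙ a (σ x)) σσx≡x ⟩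
      a x ∙ a (σ x)                           ∎

    foldMap-orbitPart : ∀ a n {xs} → length xs ≤ n → Unique xs → Closed xs → Involutive xs →
      foldMap (orbitPart a) xs ≈ foldMap a xs
    foldMap-orbitPart a n {[]} _ _ _ _ = ≈-refl
    foldMap-orbitPart a (suc n) {x ∷ xs} (s≤s |xs|≤n) unique@(_ ∷ unique-xs) closed involutive
      with σ x ≟ x
    ... | yes σx≡x = ∙-cong (orbitPart-fixed a σx≡x)
            (foldMap-orbitPart a n |xs|≤n unique-xs (closed-tail unique involutive closed σx≡x) (involutive ∘ there))
    ... | no σx≢x = begin
      orbitPart a x ∙ foldMap (orbitPart a) xs                           ≈⟨ ∙-congˡ (foldMap-remove (orbitPart a) unique-xs σx∈xs) ⟩
      orbitPart a x ∙ (orbitPart a (σ x) ∙ foldMap (orbitPart a) rest)   ≈⟨ ∙-congˡ (∙-congˡ (foldMap-orbitPart a n |rest|≤n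
                                                                              (Unique.filter⁺ _ unique-xs) (closed-remove unique involutive closed)
                                                                              (λ y∈rest → involutive (there (proj₁ (∈-filter⁻ _ {xs = xs} y∈rest)))))) ⟩
      orbitPart a x ∙ (orbitPart a (σ x) ∙ foldMap a rest)               ≈⟨ ≈-sym (assoc _ _ _) ⟩
      (orbitPart a x ∙ orbitPart a (σ x)) ∙ foldMap a rest               ≈⟨ ∙-congʳ (orbitPart-pair a (involutive (here refl)) σx≢x) ⟩
      (a x ∙ a (σ x)) ∙ foldMap a rest                                   ≈⟨ assoc _ _ _ ⟩
      a x ∙ (a (σ x) ∙ foldMap a rest)                                   ≈⟨ ∙-congˡ (foldMap-remove a unique-xs σx∈xs) ⟨
      a x ∙ foldMap a xs                                                 ∎
      where
      σx∈xs : σ x ∈ xs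
      σx∈xs = σ-∈-tail closed σx≢x
      rest : List ℕ
      rest = remove (σ x) xs
      |rest|≤n : length rest ≤ n
      |rest|≤n = ℕP.≤-trans (length-filter _ xs) |xs|≤n

    foldMap-orbits : ∀ a {xs} → InvolutionOn xs →
      foldMap a xs ≈ foldMap (fixedPart a) xs ∙ foldMap (lowerPart (λ y → a y ∙ a (σ y))) xs
    foldMap-orbits a {xs} σ-on-xs = begin
      foldMap a xs              ≈⟨ foldMap-orbitPart a (length xs) ℕP.≤-refl unique closed involutive ⟨
      foldMap (orbitPart a) xs  ≈⟨ foldMap-∙ _ _ xs ⟩
      foldMap (fixedPart a) xs ∙ foldMap (lowerPart (λ y → a y ∙ a (σ y))) xs ∎
      where open InvolutionOn σ-on-xs

module Congruence (n : ℕ) where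
  open import Data.Integer using (_+_; _*_; _-_)

  infix 4 _≈_
  -- A record rather than + n ∣ a - b itself, so that a and b can be inferred from a proof.
  record _≈_ (a b : ℤ) : Set where
    constructor mk≈
    field dvd : + n ∣ a - b
  open _≈_ public

  ≈-by : ∀ {a b e} → a - b ≡ e → + n ∣ e → a ≈ b
  ≈-by eq d = mk≈ (subst (+ n ∣_) (sym eq) d)

  +-multiple≈ : ∀ a k → a + k * + n ≈ a
  +-multiple≈ a k = mk≈ (divides k (lemma a (k * + n)))
    where
    lemma : ∀ a m → (a + m) - a ≡ m
    lemma = solve-∀

  ≈-reflexive : ∀ {a b} → a ≡ b → a ≈ b
  ≈-reflexive {a} refl = ≈-by (ℤP.+-inverseʳ a) (divides (+ 0) refl)

  ≈-refl : ∀ {a} → a ≈ a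
  ≈-refl = ≈-reflexive refl

  ≈-sym : ∀ {a b} → a ≈ b → b ≈ a
  ≈-sym {a} {b} (mk≈ d) = ≈-by (lemma a b) (∣m⇒∣-m d)
    where
    lemma : ∀ a b → b - a ≡ - (a - b)
    lemma = solve-∀

  ≈-trans : ∀ {a b c} → a ≈ b → b ≈ c → a ≈ c
  ≈-trans {a} {b} {c} (mk≈ d) (mk≈ e) = ≈-by (lemma a b c) (∣m∣n⇒∣m+n d e)
    where
    lemma : ∀ a b c → a - c ≡ (a - b) + (b - c)
    lemma = solve-∀

  *-cong : ∀ {a b c d} → a ≈ b → c ≈ d → a * c ≈ b * d
  *-cong {a} {b} {c} {d} (mk≈ e) (mk≈ f) = ≈-by (lemma a b c d) (∣m∣n⇒∣m+n (∣n⇒∣m*n a f) (∣m⇒∣m*n d e))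
    where
    lemma : ∀ a b c d → a * c - b * d ≡ a * (c - d) + (a - b) * d
    lemma = solve-∀

  -‿cong : ∀ {a b} → a ≈ b → - a ≈ - b
  -‿cong {a} {b} (mk≈ e) = ≈-by (lemma a b) (∣m⇒∣-m e)
    where
    lemma : ∀ a b → (- a) - (- b) ≡ - (a - b)
    lemma = solve-∀

  ≈⇒-≈0 : ∀ {a b} → a ≈ b → a - b ≈ + 0
  ≈⇒-≈0 {a} {b} (mk≈ d) = ≈-by (ℤP.+-identityʳ (a - b)) d

  -≈0⇒≈ : ∀ {a b} → a - b ≈ + 0 → a ≈ b
  -≈0⇒≈ {a} {b} (mk≈ d) = ≈-by (sym (ℤP.+-identityʳ (a - b))) d

  complement≈- : ∀ m r → m ℕ.+ r ≡ n → + m ≈ - + r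
  complement≈- m r m+r≡n = ≈-by eq (divides (+ 1) refl)
    where
    lemma : ∀ m r → m - (- r) ≡ + 1 * (m + r)
    lemma = solve-∀
    eq : + m - (- + r) ≡ + 1 * + n
    eq = trans (lemma (+ m) (+ r)) (cong (λ t → + 1 * t) (trans (sym (ℤP.pos-+ m r)) (cong +_ m+r≡n)))

  ∸≈- : ∀ {r} → r ≤ n → + (n ∸ r) ≈ - + r
  ∸≈- {r} r≤n = complement≈- (n ∸ r) r (ℕP.m∸n+n≡m r≤n)

  ≈⇒≡[mod] : ∀ {a b} → a ≈ b → a ≡ b [mod n ]
  ≈⇒≡[mod] (mk≈ d) = ∣⇒∣ᵤ d

  ≡[mod]⇒≈ : ∀ {a b} → a ≡ b [mod n ] → a ≈ b
  ≡[mod]⇒≈ d = mk≈ (∣ᵤ⇒∣ d)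

  ≈-isEquivalence : IsEquivalence _≈_
  ≈-isEquivalence = record { refl = ≈-refl ; sym = ≈-sym ; trans = ≈-trans }

  ≈-setoid : Setoid 0ℓ 0ℓ
  ≈-setoid = record { isEquivalence = ≈-isEquivalence }

  *-commutativeMonoid : CommutativeMonoid 0ℓ 0ℓ
  *-commutativeMonoid = record
    { Carrier = ℤ ; _≈_ = _≈_ ; _∙_ = _*_ ; ε = + 1
    ; isCommutativeMonoid = record
      { isMonoid = record
        { isSemigroup = record
          { isMagma = record
            { isEquivalence = ≈-isEquivalence
            ; ∙-cong = *-cong }
          ; assoc = λ x y z → ≈-reflexive (ℤP.*-assoc x y z) }
        ; identity = (λ x → ≈-reflexive (ℤP.*-identityˡ x)) , (λ x → ≈-reflexive (ℤP.*-identityʳ x)) }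
      ; comm = λ x y → ≈-reflexive (ℤP.*-comm x y) } }

module _ where
  open import Data.Integer using (_*_; _^_; -1ℤ)

  -1^n*-1^n≡1 : ∀ n → -1ℤ ^ n * -1ℤ ^ n ≡ + 1
  -1^n*-1^n≡1 zero = refl
  -1^n*-1^n≡1 (suc n) = trans (lemma (-1ℤ ^ n)) (-1^n*-1^n≡1 n)
    where
    lemma : ∀ t → (-1ℤ * t) * (-1ℤ * t) ≡ t * t
    lemma = solve-∀

  -1^[1+m+n]*[x*-1^n]≡-1^[1+m]*x : ∀ m n x → -1ℤ ^ suc (m ℕ.+ n) * (x * -1ℤ ^ n) ≡ -1ℤ ^ suc m * x
  -1^[1+m+n]*[x*-1^n]≡-1^[1+m]*x m n x = begin
    -1ℤ ^ suc (m ℕ.+ n) * (x * -1ℤ ^ n)           ≡⟨ cong (_* (x * -1ℤ ^ n)) (ℤP.^-distribˡ-+-* -1ℤ (suc m) n) ⟩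
    (-1ℤ ^ suc m * -1ℤ ^ n) * (x * -1ℤ ^ n)       ≡⟨ lemma (-1ℤ ^ suc m) (-1ℤ ^ n) x ⟩
    (-1ℤ ^ suc m * x) * (-1ℤ ^ n * -1ℤ ^ n)       ≡⟨ cong (-1ℤ ^ suc m * x *_) (-1^n*-1^n≡1 n) ⟩
    (-1ℤ ^ suc m * x) * + 1                       ≡⟨ ℤP.*-identityʳ _ ⟩
    -1ℤ ^ suc m * x                               ∎
    where
    open ≡-Reasoning
    lemma : ∀ s t x → (s * t) * (x * t) ≡ (s * x) * (t * t)
    lemma = solve-∀

module DoubleFactorial (n : ℕ) where
  open Congruence n
  open import Data.Integer using (_*_; _^_; -1ℤ)
  open import Algebra.Properties.CommutativeSemigroup ℕP.*-commutativeSemigroup using (x∙yz≈y∙xz)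
  open import Relation.Binary.Reasoning.Setoid ≈-setoid

  -- The even factors 2j > 2a are ≡ -(n - 2j), and these n - 2j are the odd numbers below 2b.
  !!≈±!!*!! : ∀ a b → n ≡ suc ((a ℕ.+ b) ℕ.+ (a ℕ.+ b)) →
    + (((a ℕ.+ b) ℕ.+ (a ℕ.+ b)) !!) ≈ -1ℤ ^ b * + ((a ℕ.+ a) !! ℕ.* ((b ℕ.+ b) ∸ 1) !!)
  !!≈±!!*!! a zero _ = begin
    + (((a ℕ.+ 0) ℕ.+ (a ℕ.+ 0)) !!)    ≡⟨ cong (λ t → + ((t ℕ.+ t) !!)) (ℕP.+-identityʳ a) ⟩
    + ((a ℕ.+ a) !!)                   ≡⟨ cong +_ (ℕP.*-identityʳ _) ⟨
    + ((a ℕ.+ a) !! ℕ.* 1)             ≡⟨ ℤP.*-identityˡ _ ⟨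
    -1ℤ ^ 0 * + ((a ℕ.+ a) !! ℕ.* 1)   ∎
  !!≈±!!*!! a (suc b) n≡ = begin
    + (((a ℕ.+ suc b) ℕ.+ (a ℕ.+ suc b)) !!)
      ≡⟨ cong (λ t → + ((t ℕ.+ t) !!)) (ℕP.+-suc a b) ⟩
    + (((suc a ℕ.+ b) ℕ.+ (suc a ℕ.+ b)) !!)
      ≈⟨ !!≈±!!*!! (suc a) b (trans n≡ (cong (λ t → suc (t ℕ.+ t)) (ℕP.+-suc a b))) ⟩
    -1ℤ ^ b * + ((suc a ℕ.+ suc a) !! ℕ.* E)
      ≡⟨ cong (λ t → -1ℤ ^ b * + t) even-step ⟩
    -1ℤ ^ b * + ((suc a ℕ.+ suc a) ℕ.* ((a ℕ.+ a) !! ℕ.* E))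
      ≡⟨ cong (-1ℤ ^ b *_) (ℤP.pos-* (suc a ℕ.+ suc a) _) ⟩
    -1ℤ ^ b * (+ (suc a ℕ.+ suc a) * + ((a ℕ.+ a) !! ℕ.* E))
      ≈⟨ *-cong (≈-refl { -1ℤ ^ b}) (*-cong (complement≈- (suc a ℕ.+ suc a) (suc (b ℕ.+ b)) evens+odd≡n) ≈-refl) ⟩
    -1ℤ ^ b * (- + suc (b ℕ.+ b) * + ((a ℕ.+ a) !! ℕ.* E))
      ≡⟨ sign-step (-1ℤ ^ b) (+ suc (b ℕ.+ b)) _ ⟩
    -1ℤ ^ suc b * (+ suc (b ℕ.+ b) * + ((a ℕ.+ a) !! ℕ.* E))
      ≡⟨ cong (-1ℤ ^ suc b *_) (ℤP.pos-* (suc (b ℕ.+ b)) _) ⟨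
    -1ℤ ^ suc b * + (suc (b ℕ.+ b) ℕ.* ((a ℕ.+ a) !! ℕ.* E))
      ≡⟨ cong (λ t → -1ℤ ^ suc b * + t) (x∙yz≈y∙xz (suc (b ℕ.+ b)) ((a ℕ.+ a) !!) E) ⟩
    -1ℤ ^ suc b * + ((a ℕ.+ a) !! ℕ.* (suc (b ℕ.+ b) ℕ.* E))
      ≡⟨ cong (λ t → -1ℤ ^ suc b * + ((a ℕ.+ a) !! ℕ.* t)) odd-step ⟨
    -1ℤ ^ suc b * + ((a ℕ.+ a) !! ℕ.* ((suc b ℕ.+ suc b) ∸ 1) !!) ∎
    where
    E : ℕ
    E = ((b ℕ.+ b) ∸ 1) !!
    even-step : (suc a ℕ.+ suc a) !! ℕ.* E ≡ (suc a ℕ.+ suc a) ℕ.* ((a ℕ.+ a) !! ℕ.* E)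
    even-step = trans (cong (λ t → t !! ℕ.* E) (suc+suc≡ a)) (trans (ℕP.*-assoc (suc (suc (a ℕ.+ a))) ((a ℕ.+ a) !!) E)
                  (cong (ℕ._* ((a ℕ.+ a) !! ℕ.* E)) (sym (suc+suc≡ a))))
    evens+odd≡n : (suc a ℕ.+ suc a) ℕ.+ suc (b ℕ.+ b) ≡ n
    evens+odd≡n = trans (arithmetic a b) (sym n≡)
      where
      arithmetic : ∀ a b → (suc a ℕ.+ suc a) ℕ.+ suc (b ℕ.+ b) ≡ suc ((a ℕ.+ suc b) ℕ.+ (a ℕ.+ suc b))
      arithmetic = ℕ-solve-∀
    odd-step : ((suc b ℕ.+ suc b) ∸ 1) !! ≡ suc (b ℕ.+ b) ℕ.* E
    odd-step = trans (cong (λ t → (t ∸ 1) !!) (suc+suc≡ b)) (suc-!! (b ℕ.+ b))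
    sign-step : ∀ s c y → s * (- c * y) ≡ (-1ℤ * s) * (c * y)
    sign-step = solve-∀

  !!≈±! : ∀ {h} a b → n ≡ suc (h ℕ.+ h) → h ≡ a ℕ.+ b → b ≡ a ⊎ b ≡ suc a → + ((h ℕ.+ h) !!) ≈ -1ℤ ^ b * + (h !)
  !!≈±! a b n≡ refl b≡a⊎1+a = ≈-trans (!!≈±!!*!! a b n≡) (≈-reflexive (cong (λ t → -1ℤ ^ b * + t) (!!*odd!!≡! a b b≡a⊎1+a)))


module Residues (p : ℕ) .{{_ : NonZero p}} where
  open Congruence p
  open import Data.Integer using (_+_; _*_; _-_)
  open import Data.Nat.DivMod using (_/_; m≡m%n+[m/n]*n; m<n⇒m%n≡m; [m+kn]%n≡m%n)

  ≈-% : ∀ m → + m ≈ + (m % p)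
  ≈-% m = ≈-trans (≈-reflexive (sym m≡r+qp)) (+-multiple≈ (+ (m % p)) (+ (m / p)))
    where
    m≡r+qp : + (m % p) + + (m / p) * + p ≡ + m
    m≡r+qp = begin
      + (m % p) + + (m / p) * + p   ≡⟨ cong (λ t → + (m % p) + t) (ℤP.pos-* (m / p) p) ⟨
      + (m % p) + + ((m / p) ℕ.* p) ≡⟨ ℤP.pos-+ (m % p) _ ⟨
      + (m % p ℕ.+ (m / p) ℕ.* p)   ≡⟨ cong +_ (m≡m%n+[m/n]*n m p) ⟨
      + m                           ∎
      where open ≡-Reasoning

  %≡⇒≈ : ∀ {m n} → m % p ≡ n % p → + m ≈ + n
  %≡⇒≈ {m} {n} eq = ≈-trans (≈-% m) (≈-trans (≈-reflexive (cong +_ eq)) (≈-sym (≈-% n)))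

  ≈⇒%≡-≤ : ∀ {m n} → n ≤ m → + m ≈ + n → m % p ≡ n % p
  ≈⇒%≡-≤ {m} {n} n≤m (mk≈ d) with ∣⇒∣ᵤ d
  ... | p∣m-n rewrite ℤP.m-n≡m⊖n m n | ℤP.⊖-≥ n≤m with p∣m-n
  ...   | ℕ∣.divides k m∸n≡kp = begin
    m % p                 ≡⟨ cong (_% p) (ℕP.m+[n∸m]≡n n≤m) ⟨
    (n ℕ.+ (m ∸ n)) % p   ≡⟨ cong (λ t → (n ℕ.+ t) % p) m∸n≡kp ⟩
    (n ℕ.+ k ℕ.* p) % p   ≡⟨ [m+kn]%n≡m%n n k p ⟩
    n % p                 ∎
    where open ≡-Reasoning

  ≈⇒%≡ : ∀ {m n} → + m ≈ + n → m % p ≡ n % p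
  ≈⇒%≡ {m} {n} m≈n with ℕP.≤-total n m
  ... | inj₁ n≤m = ≈⇒%≡-≤ n≤m m≈n
  ... | inj₂ m≤n = sym (≈⇒%≡-≤ m≤n (≈-sym m≈n))

  ≈⇒≡ : ∀ {m n} → m < p → n < p → + m ≈ + n → m ≡ n
  ≈⇒≡ {m} {n} m<p n<p m≈n = begin
    m       ≡⟨ m<n⇒m%n≡m m<p ⟨
    m % p   ≡⟨ ≈⇒%≡ m≈n ⟩
    n % p   ≡⟨ m<n⇒m%n≡m n<p ⟩
    n       ∎
    where open ≡-Reasoning

  invFrom-unique : ∀ j r fuel k → k ≤ r → r < k ℕ.+ fuel → (j ℕ.* r) % p ≡ 1 →
    (∀ {k′} → k ≤ k′ → k′ < k ℕ.+ fuel → (j ℕ.* k′) % p ≡ 1 → k′ ≡ r) → invFrom p j k fuel ≡ r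
  invFrom-unique j r zero k k≤r r<k+0 _ _ = ⊥-elim (ℕP.<⇒≱ (subst (r <_) (ℕP.+-identityʳ k) r<k+0) k≤r)
  invFrom-unique j r (suc fuel) k k≤r r<k+1+fuel jr≡1 unique with (j ℕ.* k) % p ≟ 1
  ... | yes jk≡1 = unique ℕP.≤-refl (ℕP.m<m+n k (s≤s z≤n)) jk≡1
  ... | no jk≢1 = invFrom-unique j r fuel (suc k) k<r (subst (r <_) (ℕP.+-suc k fuel) r<k+1+fuel) jr≡1
        λ {k′} 1+k≤k′ k′< → unique (ℕP.<⇒≤ 1+k≤k′) (subst (k′ <_) (sym (ℕP.+-suc k fuel)) k′<)
    where
    k<r : k < r
    k<r = ℕP.≤∧≢⇒< k≤r λ k≡r → jk≢1 (subst (λ t → (j ℕ.* t) % p ≡ 1) (sym k≡r) jr≡1)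

module PrimeResidues (p : ℕ) .{{_ : NonZero p}} (p-prime : Prime p) where
  open Congruence p
  open Residues p
  open import Data.Integer using (_+_; _*_; _-_)
  open import Data.Nat.DivMod using (m<n⇒m%n≡m)
  open import Data.Integer.DivMod using () renaming (_%_ to _%ℤ_; _/_ to _/ℤ_; n%d<d to n%ℤd<d; a≡a%n+[a/n]*n to a≡a%ℤn+[a/n]*n)
  open import Data.Nat.Coprimality using (prime⇒coprime; coprime-Bézout)
  open import Data.Nat.GCD using (module Bézout)

  1<p : 1 < p
  1<p = ℕ.nonTrivial⇒n>1 p {{prime⇒nonTrivial p-prime}}

  0<p : 0 < p
  0<p = ℕP.<-trans (s≤s z≤n) 1<p

  0≉1 : ¬ (+ 0 ≈ + 1)
  0≉1 0≈1 with ≈⇒≡ 0<p 1<p 0≈1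
  ... | ()

  *≈0⇒≈0⊎≈0 : ∀ a b → a * b ≈ + 0 → a ≈ + 0 ⊎ b ≈ + 0
  *≈0⇒≈0⊎≈0 a b (mk≈ p∣ab-0) = Sum.map ≈0 ≈0 (euclidsLemma ∣ a ∣ ∣ b ∣ p-prime p∣∣a∣∣b∣)
    where
    p∣∣a∣∣b∣ : p ℕ∣.∣ ∣ a ∣ ℕ.* ∣ b ∣
    p∣∣a∣∣b∣ = subst (p ℕ∣.∣_) (ℤP.abs-* a b) (subst (λ t → p ℕ∣.∣ ∣ t ∣) (ℤP.+-identityʳ (a * b)) (∣⇒∣ᵤ p∣ab-0))
    ≈0 : ∀ {c} → p ℕ∣.∣ ∣ c ∣ → c ≈ + 0
    ≈0 {c} p∣c = ≈-by (ℤP.+-identityʳ c) (∣ᵤ⇒∣ p∣c)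

  ≈0⇒≡0 : ∀ {x} → x < p → + x ≈ + 0 → x ≡ 0
  ≈0⇒≡0 x<p = ≈⇒≡ x<p 0<p

  *-cancelˡ-≈ : ∀ {x} y z → 0 < x → x < p → + x * y ≈ + x * z → y ≈ z
  *-cancelˡ-≈ {x} y z 0<x x<p xy≈xz =
    Sum.[ (λ x≈0 → ⊥-elim (ℕP.<⇒≢ 0<x (sym (≈0⇒≡0 x<p x≈0)))) , -≈0⇒≈ {y} {z} ]′ (*≈0⇒≈0⊎≈0 (+ x) (y - z) x[y-z]≈0)
    where
    lemma : ∀ x y z → x * (y - z) ≡ x * y - x * z
    lemma = solve-∀
    x[y-z]≈0 : + x * (y - z) ≈ + 0
    x[y-z]≈0 = ≈-trans (≈-reflexive (lemma (+ x) y z)) (≈⇒-≈0 xy≈xz)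

  Bézout⇒inverse : ∀ {x} → Bézout.Identity 1 p x → ∃ λ y → + x * y ≈ + 1
  Bézout⇒inverse {x} (Bézout.+- a b 1+bx≡ap) = - (+ b) , ≈-by eq (divides (- (+ a)) refl)
    where
    lemma : ∀ x b → x * - b - + 1 ≡ - (+ 1 + b * x)
    lemma = solve-∀
    eq : + x * - (+ b) - + 1 ≡ - (+ a) * + p
    eq = begin
      + x * - (+ b) - + 1   ≡⟨ lemma (+ x) (+ b) ⟩
      - (+ 1 + + b * + x)   ≡⟨ cong (λ t → - (+ 1 + t)) (ℤP.pos-* b x) ⟨
      - + (1 ℕ.+ b ℕ.* x)   ≡⟨ cong (-_ ∘ +_) 1+bx≡ap ⟩
      - + (a ℕ.* p)         ≡⟨ cong -_ (ℤP.pos-* a p) ⟩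
      - (+ a * + p)         ≡⟨ ℤP.neg-distribˡ-* (+ a) (+ p) ⟩
      - (+ a) * + p         ∎
      where open ≡-Reasoning
  Bézout⇒inverse {x} (Bézout.-+ a b 1+ap≡bx) = + b , ≈-by eq (divides (+ a) refl)
    where
    lemma : ∀ m → (+ 1 + m) - + 1 ≡ m
    lemma = solve-∀
    eq : + x * + b - + 1 ≡ + a * + p
    eq = begin
      + x * + b - + 1               ≡⟨ cong (_- + 1) (ℤP.*-comm (+ x) (+ b)) ⟩
      + b * + x - + 1               ≡⟨ cong (_- + 1) (ℤP.pos-* b x) ⟨
      + (b ℕ.* x) - + 1             ≡⟨ cong (λ t → + t - + 1) 1+ap≡bx ⟨
      + (1 ℕ.+ a ℕ.* p) - + 1       ≡⟨ cong (_- + 1) (ℤP.pos-+ 1 (a ℕ.* p)) ⟩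
      (+ 1 + + (a ℕ.* p)) - + 1     ≡⟨ lemma (+ (a ℕ.* p)) ⟩
      + (a ℕ.* p)                   ≡⟨ ℤP.pos-* a p ⟩
      + a * + p                     ∎
      where open ≡-Reasoning

  inverse-exists : ∀ {x} → 0 < x → x < p → ∃ λ r → r < p × + x * + r ≈ + 1
  inverse-exists {x@(suc _)} _ x<p with y , xy≈1 ← Bézout⇒inverse (coprime-Bézout (prime⇒coprime p-prime x<p)) =
    y %ℤ + p , n%ℤd<d y (+ p) , ≈-trans (*-cong (≈-refl {+ x}) y%p≈y) xy≈1
    where
    y%p≈y : + (y %ℤ + p) ≈ y
    y%p≈y = ≈-sym (≈-trans (≈-reflexive (a≡a%ℤn+[a/n]*n y (+ p))) (+-multiple≈ _ (y /ℤ + p)))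

  inverse-positive : ∀ {x r} → + x * + r ≈ + 1 → 0 < r
  inverse-positive {x} {zero} x0≈1 = ⊥-elim (0≉1 (≈-trans (≈-reflexive (sym (ℤP.*-zeroʳ (+ x)))) x0≈1))
  inverse-positive {r = suc _} _ = s≤s z≤n

  invMod-unique : ∀ {x r} → 0 < x → x < p → r < p → + x * + r ≈ + 1 → invMod p x ≡ r
  invMod-unique {x} {r} 0<x x<p r<p xr≈1 =
    invFrom-unique x r (p ∸ 1) 1 (inverse-positive {x} xr≈1) (subst (r <_) (sym 1+[p∸1]≡p) r<p) (%≡1 xr≈1) unique
    where
    1+[p∸1]≡p : 1 ℕ.+ (p ∸ 1) ≡ p
    1+[p∸1]≡p = ℕP.m+[n∸m]≡n 0<p
    1%p≡1 : 1 % p ≡ 1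
    1%p≡1 = m<n⇒m%n≡m 1<p
    %≡1 : ∀ {k} → + x * + k ≈ + 1 → (x ℕ.* k) % p ≡ 1
    %≡1 {k} xk≈1 = trans (≈⇒%≡ (≈-trans (≈-reflexive (ℤP.pos-* x k)) xk≈1)) 1%p≡1
    unique : ∀ {k} → 1 ≤ k → k < 1 ℕ.+ (p ∸ 1) → (x ℕ.* k) % p ≡ 1 → k ≡ r
    unique {k} _ k<p xk%p≡1 = ≈⇒≡ (subst (k <_) 1+[p∸1]≡p k<p) r<p
      (*-cancelˡ-≈ (+ k) (+ r) 0<x x<p (≈-trans xk≈1 (≈-sym xr≈1)))
      where
      xk≈1 : + x * + k ≈ + 1
      xk≈1 = ≈-trans (≈-reflexive (sym (ℤP.pos-* x k))) (%≡⇒≈ (trans xk%p≡1 (sym 1%p≡1)))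

  invMod-inverse : ∀ {x} → 0 < x → x < p → invMod p x < p × + x * + invMod p x ≈ + 1
  invMod-inverse {x} 0<x x<p with r , r<p , xr≈1 ← inverse-exists 0<x x<p =
    subst (λ t → t < p × + x * + t ≈ + 1) (sym (invMod-unique 0<x x<p r<p xr≈1)) (r<p , xr≈1)

  square≈square⇒≡ : ∀ {x c} → 2 ℕ.* x < p → 2 ℕ.* c < p → + x * + x ≈ + c * + c → x ≡ c
  square≈square⇒≡ {x} {c} 2x<p 2c<p x²≈c² =
    Sum.[ x-c≈0⇒x≡c , x+c≈0⇒x≡c ]′ (*≈0⇒≈0⊎≈0 (+ x - + c) (+ x + + c) x²-c²≈0)
    where
    lemma : ∀ x c → (x - c) * (x + c) ≡ x * x - c * c
    lemma = solve-∀
    x²-c²≈0 : (+ x - + c) * (+ x + + c) ≈ + 0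
    x²-c²≈0 = ≈-trans (≈-reflexive (lemma (+ x) (+ c))) (≈⇒-≈0 x²≈c²)
    x-c≈0⇒x≡c : + x - + c ≈ + 0 → x ≡ c
    x-c≈0⇒x≡c x-c≈0 = ≈⇒≡ (double<⇒< {x} 2x<p) (double<⇒< {c} 2c<p) (-≈0⇒≈ x-c≈0)
    x+c≈0⇒x≡c : + x + + c ≈ + 0 → x ≡ c
    x+c≈0⇒x≡c x+c≈0 = trans (ℕP.m+n≡0⇒m≡0 x x+c≡0) (sym (ℕP.m+n≡0⇒n≡0 x x+c≡0))
      where
      x+c≡0 : x ℕ.+ c ≡ 0
      x+c≡0 = ≈0⇒≡0 (+<-of-doubles< {x} {c} 2x<p 2c<p) (≈-trans (≈-reflexive (ℤP.pos-+ x c)) x+c≈0)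

module HalfSystem (p : ℕ) .{{_ : NonZero p}} (p-prime : Prime p) (p%2≡1 : p % 2 ≡ 1) where
  open Congruence p
  open PrimeResidues p p-prime
  open import Data.Integer using (_*_; _^_; -1ℤ)

  Small : ℕ → Set
  Small x = 2 ℕ.* x < p

  small? : ∀ x → Dec (Small x)
  small? x = 2 ℕ.* x <? p

  complement-small : ∀ {r} → r < p → ¬ Small r → Small (p ∸ r)
  complement-small {r} r<p r-large = begin-strict
    2 ℕ.* (p ∸ r)       ≡⟨ double≡+ (p ∸ r) ⟩
    (p ∸ r) ℕ.+ (p ∸ r) <⟨ ℕP.+-monoʳ-< (p ∸ r) p∸r<r ⟩
    (p ∸ r) ℕ.+ r       ≡⟨ ℕP.m∸n+n≡m (ℕP.<⇒≤ r<p) ⟩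
    p                   ∎
    where
    open ℕP.≤-Reasoning
    p<r+r : p < r ℕ.+ r
    p<r+r = subst (p <_) (double≡+ r) (ℕP.≤∧≢⇒< (ℕP.≮⇒≥ r-large) (odd≢double p%2≡1 r))
    p∸r<r : p ∸ r < r
    p∸r<r = ℕP.+-cancelʳ-< r (p ∸ r) r (subst (_< r ℕ.+ r) (sym (ℕP.m∸n+n≡m (ℕP.<⇒≤ r<p))) p<r+r)

  complement-large : ∀ {r} → r < p → Small r → ¬ Small (p ∸ r)
  complement-large {r} r<p 2r<p 2[p∸r]<p = ℕP.<-asym 2r<p (begin-strict
    p              ≡⟨ ℕP.m∸n+n≡m (ℕP.<⇒≤ r<p) ⟨
    (p ∸ r) ℕ.+ r  <⟨ ℕP.+-monoˡ-< r p∸r<r ⟩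
    r ℕ.+ r        ≡⟨ double≡+ r ⟨
    2 ℕ.* r        ∎)
    where
    open ℕP.≤-Reasoning
    p∸r<r : p ∸ r < r
    p∸r<r = ℕP.+-cancelˡ-< (p ∸ r) (p ∸ r) r
      (subst₂ _<_ (double≡+ (p ∸ r)) (sym (ℕP.m∸n+n≡m (ℕP.<⇒≤ r<p))) 2[p∸r]<p)

  inv : ℕ → ℕ
  inv = invMod p

  -- σ x is the one of ±x⁻¹ lying in (0, p/2), and ν x = 1 when it is -x⁻¹;
  -- the paper's μ counts the x ≤ (p - 1)/2 with χ x = 1.
  σ : ℕ → ℕ
  σ x with small? (inv x)
  ... | yes _ = inv x
  ... | no _ = p ∸ inv x

  ν : ℕ → ℕ
  ν x with small? (inv x)
  ... | yes _ = 0
  ... | no _ = 1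

  χ : ℕ → ℕ
  χ x = 1 ∸ ν x

  Half : ℕ → Set
  Half x = 0 < x × Small x

  χ+ν≡1 : ∀ x → χ x ℕ.+ ν x ≡ 1
  χ+ν≡1 x with small? (inv x)
  ... | yes _ = refl
  ... | no _ = refl

  σ-when-small : ∀ {y} → Small (inv y) → σ y ≡ inv y × ν y ≡ 0
  σ-when-small {y} s with small? (inv y)
  ... | yes _ = refl , refl
  ... | no ¬s = ⊥-elim (¬s s)

  σ-when-large : ∀ {y} → ¬ Small (inv y) → σ y ≡ p ∸ inv y × ν y ≡ 1
  σ-when-large {y} ¬s with small? (inv y)
  ... | yes s = ⊥-elim (¬s s)
  ... | no _ = refl , refl

  2<p : 2 < p
  2<p = ℕP.≤∧≢⇒< 1<p (λ 2≡p → odd≢double p%2≡1 1 (sym 2≡p))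

  inv-1 : inv 1 ≡ 1
  inv-1 = invMod-unique (s≤s z≤n) 1<p 1<p ≈-refl

  σ-1 : σ 1 ≡ 1
  σ-1 = trans (proj₁ (σ-when-small (subst Small (sym inv-1) 2<p))) inv-1

  module _ {x} (x-half : Half x) where
    private
      0<x : 0 < x
      0<x = proj₁ x-half
      x-small : Small x
      x-small = proj₂ x-half
      x<p : x < p
      x<p = double<⇒< {x} x-small
      r : ℕ
      r = inv x
      r<p : r < p
      r<p = proj₁ (invMod-inverse 0<x x<p)
      xr≈1 : + x * + r ≈ + 1
      xr≈1 = proj₂ (invMod-inverse 0<x x<p)
      0<r : 0 < r
      0<r = inverse-positive {x} xr≈1

    σ-half : Half (σ x)
    σ-half with small? r
    ... | yes r-small = 0<r , r-small
    ... | no r-large = ℕP.m<n⇒0<n∸m r<p , complement-small r<p r-large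

    σ-mul : + x * + σ x ≈ -1ℤ ^ ν x
    σ-mul with small? r
    ... | yes _ = xr≈1
    ... | no _ = begin
      + x * + (p ∸ r)   ≈⟨ *-cong (≈-refl {+ x}) (∸≈- (ℕP.<⇒≤ r<p)) ⟩
      + x * - + r       ≡⟨ ℤP.neg-distribʳ-* (+ x) (+ r) ⟨
      - (+ x * + r)     ≈⟨ -‿cong xr≈1 ⟩
      -1ℤ               ∎
      where open import Relation.Binary.Reasoning.Setoid ≈-setoid

    σ-involution : σ (σ x) ≡ x × ν (σ x) ≡ ν x
    σ-involution with small? r
    ... | yes r-small = trans σr≡invr invr≡x , νr≡0
      where
      invr≡x : inv r ≡ x
      invr≡x = invMod-unique 0<r r<p x<p (≈-trans (≈-reflexive (ℤP.*-comm (+ r) (+ x))) xr≈1)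
      σr≡invr : σ r ≡ inv r
      σr≡invr = proj₁ (σ-when-small (subst Small (sym invr≡x) x-small))
      νr≡0 : ν r ≡ 0
      νr≡0 = proj₂ (σ-when-small (subst Small (sym invr≡x) x-small))
    ... | no r-large = trans σs≡p∸invs (trans (cong (p ∸_) invs≡p∸x) (ℕP.m∸[m∸n]≡n (ℕP.<⇒≤ x<p))) , νs≡1
      where
      lemma : ∀ a b → - a * - b ≡ b * a
      lemma = solve-∀
      invs≡p∸x : inv (p ∸ r) ≡ p ∸ x
      invs≡p∸x = invMod-unique (ℕP.m<n⇒0<n∸m r<p) (ℕP.∸-monoʳ-< 0<r (ℕP.<⇒≤ r<p)) (ℕP.∸-monoʳ-< 0<x (ℕP.<⇒≤ x<p))
        (≈-trans (*-cong (∸≈- (ℕP.<⇒≤ r<p)) (∸≈- (ℕP.<⇒≤ x<p))) (≈-trans (≈-reflexive (lemma (+ r) (+ x))) xr≈1))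
      s-case : σ (p ∸ r) ≡ p ∸ inv (p ∸ r) × ν (p ∸ r) ≡ 1
      s-case = σ-when-large (subst (¬_ ∘ Small) (sym invs≡p∸x) (complement-large x<p x-small))
      σs≡p∸invs : σ (p ∸ r) ≡ p ∸ inv (p ∸ r)
      σs≡p∸invs = proj₁ s-case
      νs≡1 : ν (p ∸ r) ≡ 1
      νs≡1 = proj₂ s-case

    σ-involutive : σ (σ x) ≡ x
    σ-involutive = proj₁ σ-involution

    ν-σ : ν (σ x) ≡ ν x
    ν-σ = proj₂ σ-involution

    fixed-square : σ x ≡ x → + x * + x ≈ -1ℤ ^ ν x
    fixed-square σx≡x = subst (λ t → + x * + t ≈ -1ℤ ^ ν x) σx≡x σ-mul

    fixed-negative : σ x ≡ x → x ≢ 1 → ν x ≡ 1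
    fixed-negative σx≡x x≢1 with small? r | fixed-square σx≡x
    ... | yes _ | x²≈1 = ⊥-elim (x≢1 (square≈square⇒≡ x-small 2<p x²≈1))
    ... | no _ | _ = refl

    square≈-1⇒fixed : + x * + x ≈ -1ℤ → σ x ≡ x
    square≈-1⇒fixed x²≈-1 = trans (proj₁ (σ-when-large (subst (¬_ ∘ Small) (sym r≡p∸x) (complement-large x<p x-small))))
                               (trans (cong (p ∸_) r≡p∸x) (ℕP.m∸[m∸n]≡n (ℕP.<⇒≤ x<p)))
      where
      lemma : ∀ a → a * - a ≡ - (a * a)
      lemma = solve-∀
      r≡p∸x : r ≡ p ∸ x
      r≡p∸x = invMod-unique 0<x x<p (ℕP.∸-monoʳ-< 0<x (ℕP.<⇒≤ x<p))
        (≈-trans (*-cong (≈-refl {+ x}) (∸≈- (ℕP.<⇒≤ x<p))) (≈-trans (≈-reflexive (lemma (+ x))) (-‿cong x²≈-1)))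

  fixed-unique : ∀ {x c} → Half x → Half c → σ x ≡ x → σ c ≡ c → x ≢ 1 → c ≢ 1 → x ≡ c
  fixed-unique {x} {c} x-half c-half σx≡x σc≡c x≢1 c≢1 = square≈square⇒≡ (proj₂ x-half) (proj₂ c-half)
    (≈-trans (fixed-square x-half σx≡x) (≈-trans (≈-reflexive (cong (-1ℤ ^_) (trans (fixed-negative x-half σx≡x x≢1)
      (sym (fixed-negative c-half σc≡c c≢1))))) (≈-sym (fixed-square c-half σc≡c))))

module DoubleFactorialModPrime (p : ℕ) .{{_ : NonZero p}} (p-prime : Prime p) (p%2≡1 : p % 2 ≡ 1) where
  open Congruence p
  open PrimeResidues p p-prime
  open HalfSystem p p-prime p%2≡1
  open Orbits σ using (InvolutionOn)
  open import Data.Integer using (_*_; _^_; -1ℤ)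
  open import Data.Nat.DivMod using (_/_; m≡m%n+[m/n]*n; m*n/n≡m; [m+kn]%n≡m%n)
  open import Data.List.Relation.Unary.Any using (any?)
  open import Data.List.Membership.Propositional using (find; lose)
  module Σ = BigOperator ℕP.+-0-commutativeMonoid
  module Π = BigOperator *-commutativeMonoid

  h : ℕ
  h = p / 2

  p≡1+2h : p ≡ suc (h ℕ.+ h)
  p≡1+2h = trans (m≡m%n+[m/n]*n p 2) (cong₂ ℕ._+_ p%2≡1 (trans (ℕP.*-comm h 2) (double≡+ h)))

  small⇒≤h : ∀ {x} → Small x → x ≤ h
  small⇒≤h {x} 2x<p = ℕP.≮⇒≥ λ h<x →
    ℕP.<⇒≱ (ℕP.+-mono-< h<x h<x) (ℕP.≤-pred (subst₂ _<_ (double≡+ x) p≡1+2h 2x<p))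

  ≤h⇒small : ∀ {x} → x ≤ h → Small x
  ≤h⇒small {x} x≤h = subst₂ _<_ (sym (double≡+ x)) (sym p≡1+2h) (s≤s (ℕP.+-mono-≤ x≤h x≤h))

  k : ℕ
  k = h ∸ 1

  h≡1+k : h ≡ suc k
  h≡1+k = sym (ℕP.m+[n∸m]≡n (small⇒≤h {1} 2<p))

  -- 1 is always fixed by σ; splitting it off leaves a square root of -1 as the only possible fixed point.
  [2,h] : List ℕ
  [2,h] = applyUpTo (2 ℕ.+_) k

  ∈[2,h]⇒half : ∀ {x} → x ∈ [2,h] → Half x
  ∈[2,h]⇒half x∈ with i , i<k , refl ← ∈-applyUpTo⁻ (2 ℕ.+_) x∈ =
    s≤s z≤n , ≤h⇒small (subst (2 ℕ.+ i ≤_) (sym h≡1+k) (s≤s i<k))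

  ∈[2,h]⇒≢1 : ∀ {x} → x ∈ [2,h] → x ≢ 1
  ∈[2,h]⇒≢1 x∈ with i , _ , refl ← ∈-applyUpTo⁻ (2 ℕ.+_) x∈ = λ ()

  half⇒∈[2,h] : ∀ {x} → Half x → x ≢ 1 → x ∈ [2,h]
  half⇒∈[2,h] {suc zero} _ x≢1 = ⊥-elim (x≢1 refl)
  half⇒∈[2,h] {suc (suc i)} (_ , x-small) _ =
    ∈-applyUpTo⁺ (2 ℕ.+_) (ℕP.≤-pred (subst (2 ℕ.+ i ≤_) h≡1+k (small⇒≤h x-small)))

  [2,h]-unique : Unique [2,h]
  [2,h]-unique = Unique.applyUpTo⁺₁ (2 ℕ.+_) k (λ i<j _ → ℕP.<⇒≢ (s≤s (s≤s i<j)))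

  σ-on-[2,h] : InvolutionOn [2,h]
  σ-on-[2,h] = record
    { unique = [2,h]-unique
    ; closed = closed
    ; involutive = σ-involutive ∘ ∈[2,h]⇒half
    }
    where
    closed : ∀ {x} → x ∈ [2,h] → σ x ∈ [2,h]
    closed x∈ = half⇒∈[2,h] (σ-half (∈[2,h]⇒half x∈)) λ σx≡1 →
      ∈[2,h]⇒≢1 x∈ (trans (sym (σ-involutive (∈[2,h]⇒half x∈))) (trans (cong σ σx≡1) σ-1))

  pairs⁺ pairs⁻ fixedCount : ℕ
  pairs⁺ = Σ.foldMap (Σ.lowerPart σ χ) [2,h]
  pairs⁻ = Σ.foldMap (Σ.lowerPart σ ν) [2,h]
  fixedCount = Σ.foldMap (Σ.fixedPart σ (λ _ → 1)) [2,h]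

  fixedProduct : ℤ
  fixedProduct = Π.foldMap (Π.fixedPart σ +_) [2,h]

  k≡fixed+2pairs : k ≡ fixedCount ℕ.+ ((pairs⁺ ℕ.+ pairs⁻) ℕ.+ (pairs⁺ ℕ.+ pairs⁻))
  k≡fixed+2pairs = begin
    k                                          ≡⟨ length-applyUpTo (2 ℕ.+_) k ⟨
    length [2,h]                               ≡⟨ foldMap-1≡length [2,h] ⟨
    Σ.foldMap (λ _ → 1) [2,h]                  ≡⟨ Σ.foldMap-orbits σ (λ _ → 1) σ-on-[2,h] ⟩
    fixedCount ℕ.+ Σ.foldMap (Σ.lowerPart σ (λ _ → 2)) [2,h]   ≡⟨ cong (fixedCount ℕ.+_) pairs-twice ⟩
    fixedCount ℕ.+ ((pairs⁺ ℕ.+ pairs⁻) ℕ.+ (pairs⁺ ℕ.+ pairs⁻)) ∎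
    where
    open ≡-Reasoning
    foldMap-1≡length : ∀ xs → Σ.foldMap (λ _ → 1) xs ≡ length xs
    foldMap-1≡length [] = refl
    foldMap-1≡length (_ ∷ xs) = cong suc (foldMap-1≡length xs)
    split : ∀ x → Σ.lowerPart σ (λ _ → 2) x ≡ (Σ.lowerPart σ χ x ℕ.+ Σ.lowerPart σ ν x) ℕ.+ (Σ.lowerPart σ χ x ℕ.+ Σ.lowerPart σ ν x)
    split x = begin
      Σ.lowerPart σ (λ _ → 2) x                          ≡⟨ Σ.lowerPart-cong σ (λ _ → 2) (λ y → c y ℕ.+ c y) (cong₂ ℕ._+_ (sym (χ+ν≡1 x)) (sym (χ+ν≡1 x))) ⟩
      Σ.lowerPart σ (λ y → c y ℕ.+ c y) x                ≡⟨ Σ.lowerPart-∙ σ c c x ⟩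
      Σ.lowerPart σ c x ℕ.+ Σ.lowerPart σ c x            ≡⟨ cong₂ ℕ._+_ (Σ.lowerPart-∙ σ χ ν x) (Σ.lowerPart-∙ σ χ ν x) ⟩
      (Σ.lowerPart σ χ x ℕ.+ Σ.lowerPart σ ν x) ℕ.+ (Σ.lowerPart σ χ x ℕ.+ Σ.lowerPart σ ν x) ∎
      where
      c : ℕ → ℕ
      c y = χ y ℕ.+ ν y
    pairs-twice : Σ.foldMap (Σ.lowerPart σ (λ _ → 2)) [2,h] ≡ (pairs⁺ ℕ.+ pairs⁻) ℕ.+ (pairs⁺ ℕ.+ pairs⁻)
    pairs-twice = trans (Σ.foldMap-cong [2,h] (λ {x} _ → split x))
      (trans (Σ.foldMap-∙ _ _ [2,h]) (cong₂ ℕ._+_ (Σ.foldMap-∙ _ _ [2,h]) (Σ.foldMap-∙ _ _ [2,h])))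

  count-small : ∀ f ys → length (filter (λ j → small? (inv (f j))) ys) ≡ Σ.foldMap (χ ∘ f) ys
  count-small f [] = refl
  count-small f (j ∷ ys) with small? (inv (f j))
  ... | yes s = trans (cong length (filter-accept (λ j → small? (inv (f j))) s)) (cong suc (count-small f ys))
  ... | no ¬s = trans (cong length (filter-reject (λ j → small? (inv (f j))) ¬s)) (count-small f ys)

  χ-1 : χ 1 ≡ 1
  χ-1 = cong (1 ∸_) (proj₂ (σ-when-small (subst Small (sym inv-1) 2<p)))

  mu≡1+2pairs⁺ : mu p ≡ suc (pairs⁺ ℕ.+ pairs⁺)
  mu≡1+2pairs⁺ = begin
    mu p                                                  ≡⟨ cong (λ t → length (filter (λ j → small? (inv (suc j))) (upTo t))) h≡1+k ⟩
    length (filter (λ j → small? (inv (suc j))) (upTo (suc k)))  ≡⟨ count-small suc (upTo (suc k)) ⟩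
    χ 1 ℕ.+ Σ.foldMap (χ ∘ suc) (applyUpTo suc k)         ≡⟨ cong₂ ℕ._+_ χ-1 (sym (Σ.foldMap-map χ suc (applyUpTo suc k))) ⟩
    suc (Σ.foldMap χ (map suc (applyUpTo suc k)))         ≡⟨ cong (suc ∘ Σ.foldMap χ) (map-applyUpTo suc suc k) ⟩
    suc (Σ.foldMap χ [2,h])                               ≡⟨ cong suc (Σ.foldMap-orbits σ χ σ-on-[2,h]) ⟩
    suc (Σ.foldMap (Σ.fixedPart σ χ) [2,h] ℕ.+ Σ.foldMap (Σ.lowerPart σ (λ y → χ y ℕ.+ χ (σ y))) [2,h])
      ≡⟨ cong suc (cong₂ ℕ._+_ (Σ.foldMap-ε [2,h] fixed-χ≡0) (Σ.foldMap-cong [2,h] lower-doubles)) ⟩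
    suc (0 ℕ.+ Σ.foldMap (λ x → Σ.lowerPart σ χ x ℕ.+ Σ.lowerPart σ χ x) [2,h])
      ≡⟨ cong suc (Σ.foldMap-∙ (Σ.lowerPart σ χ) (Σ.lowerPart σ χ) [2,h]) ⟩
    suc (pairs⁺ ℕ.+ pairs⁺) ∎
    where
    open ≡-Reasoning
    fixed-χ≡0 : ∀ {x} → x ∈ [2,h] → Σ.fixedPart σ χ x ≡ 0
    fixed-χ≡0 x∈ = Σ.fixedPart-ε σ χ λ σx≡x →
      cong (1 ∸_) (fixed-negative (∈[2,h]⇒half x∈) σx≡x (∈[2,h]⇒≢1 x∈))
    lower-doubles : ∀ {x} → x ∈ [2,h] → Σ.lowerPart σ (λ y → χ y ℕ.+ χ (σ y)) x ≡ Σ.lowerPart σ χ x ℕ.+ Σ.lowerPart σ χ x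
    lower-doubles {x} x∈ = trans (Σ.lowerPart-cong σ (λ y → χ y ℕ.+ χ (σ y)) (λ y → χ y ℕ.+ χ y) (cong (λ t → χ x ℕ.+ (1 ∸ t)) (ν-σ (∈[2,h]⇒half x∈))))
                                 (Σ.lowerPart-∙ σ χ χ x)

  factorial≈ : ∀ n → Π.foldMap +_ (applyUpTo suc n) ≈ + (n !)
  factorial≈ zero = ≈-refl
  factorial≈ (suc n) = begin
    Π.foldMap +_ (applyUpTo suc (suc n))       ≡⟨ cong (Π.foldMap +_) (applyUpTo-∷ʳ suc n) ⟨
    Π.foldMap +_ (applyUpTo suc n ∷ʳ suc n)    ≈⟨ Π.foldMap-∷ʳ +_ (applyUpTo suc n) (suc n) ⟩
    + suc n * Π.foldMap +_ (applyUpTo suc n)   ≈⟨ *-cong (≈-refl {+ suc n}) (factorial≈ n) ⟩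
    + suc n * + (n !)                          ≡⟨ ℤP.pos-* (suc n) (n !) ⟨
    + (suc n !)                                ∎
    where open import Relation.Binary.Reasoning.Setoid ≈-setoid

  foldMap-sign : ∀ g xs → Π.foldMap (λ x → -1ℤ ^ g x) xs ≡ -1ℤ ^ Σ.foldMap g xs
  foldMap-sign g [] = refl
  foldMap-sign g (x ∷ xs) = trans (cong (-1ℤ ^ g x *_) (foldMap-sign g xs)) (sym (ℤP.^-distribˡ-+-* -1ℤ (g x) _))

  lowerPart-sign : ∀ g x → Π.lowerPart σ (λ y → -1ℤ ^ g y) x ≡ -1ℤ ^ Σ.lowerPart σ g x
  lowerPart-sign g x with Orbits.position σ x
  ... | Orbits.fixed _ = refl
  ... | Orbits.lower _ = refl
  ... | Orbits.upper _ = refl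

  h!≈fixedProduct*sign : + (h !) ≈ fixedProduct * -1ℤ ^ pairs⁻
  h!≈fixedProduct*sign = begin
    + (h !)                                    ≡⟨ cong (λ t → + (t !)) h≡1+k ⟩
    + (suc k !)                                ≈⟨ factorial≈ (suc k) ⟨
    + 1 * Π.foldMap +_ [2,h]                   ≡⟨ ℤP.*-identityˡ _ ⟩
    Π.foldMap +_ [2,h]                         ≈⟨ Π.foldMap-orbits σ +_ σ-on-[2,h] ⟩
    fixedProduct * Π.foldMap (Π.lowerPart σ (λ y → + y * + σ y)) [2,h]
      ≈⟨ *-cong (≈-refl {fixedProduct}) (Π.foldMap-cong [2,h] λ x∈ → Π.lowerPart-cong σ (λ y → + y * + σ y) (λ y → -1ℤ ^ ν y) (σ-mul (∈[2,h]⇒half x∈))) ⟩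
    fixedProduct * Π.foldMap (Π.lowerPart σ (λ y → -1ℤ ^ ν y)) [2,h]
      ≈⟨ *-cong (≈-refl {fixedProduct}) (≈-trans (Π.foldMap-cong [2,h] λ {x} _ → ≈-reflexive (lowerPart-sign ν x)) (≈-reflexive (foldMap-sign (Σ.lowerPart σ ν) [2,h]))) ⟩
    fixedProduct * -1ℤ ^ pairs⁻                ∎
    where open import Relation.Binary.Reasoning.Setoid ≈-setoid

  fixed-points-unique : ∀ {c x} → c ∈ [2,h] → σ c ≡ c → x ∈ [2,h] → x ≢ c → σ x ≢ x
  fixed-points-unique c∈ σc≡c x∈ x≢c σx≡x = x≢c (fixed-unique (∈[2,h]⇒half x∈) (∈[2,h]⇒half c∈)
    σx≡x σc≡c (∈[2,h]⇒≢1 x∈) (∈[2,h]⇒≢1 c∈))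

  no-fixed-point : (∀ {x} → x ∈ [2,h] → σ x ≢ x) → fixedCount ≡ 0 × fixedProduct ≈ + 1
  no-fixed-point none = Σ.foldMap-ε [2,h] (λ x∈ → Σ.fixedPart-ε σ _ (⊥-elim ∘ none x∈))
                      , Π.foldMap-ε [2,h] (λ x∈ → Π.fixedPart-ε σ +_ (⊥-elim ∘ none x∈))

  one-fixed-point : ∀ {c} → c ∈ [2,h] → σ c ≡ c → fixedCount ≡ 1 × fixedProduct ≈ + c
  one-fixed-point c∈ σc≡c =
    trans (Σ.foldMap-single [2,h]-unique c∈ λ x∈ x≢c → Σ.fixedPart-ε σ _ (⊥-elim ∘ fixed-points-unique c∈ σc≡c x∈ x≢c))
          (Σ.fixedPart-fixed σ _ σc≡c) ,
    ≈-trans (Π.foldMap-single {f = Π.fixedPart σ +_} [2,h]-unique c∈ λ x∈ x≢c → Π.fixedPart-ε σ +_ (⊥-elim ∘ fixed-points-unique c∈ σc≡c x∈ x≢c))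
          (Π.fixedPart-fixed σ +_ σc≡c)

  !!≈sign*fixedProduct : fixedCount ≡ 0 ⊎ fixedCount ≡ 1 → + ((p ∸ 1) !!) ≈ -1ℤ ^ ((mu p ℕ.+ 1) / 2) * fixedProduct
  !!≈sign*fixedProduct fixedCount≤1 = begin
    + ((p ∸ 1) !!)                             ≡⟨ cong (λ t → + ((t ∸ 1) !!)) p≡1+2h ⟩
    + ((h ℕ.+ h) !!)                           ≈⟨ DoubleFactorial.!!≈±! p (fixedCount ℕ.+ P) (suc P) p≡1+2h h≡a+b halves ⟩
    -1ℤ ^ suc P * + (h !)                      ≈⟨ *-cong (≈-refl { -1ℤ ^ suc P}) h!≈fixedProduct*sign ⟩
    -1ℤ ^ suc P * (fixedProduct * -1ℤ ^ pairs⁻) ≡⟨ -1^[1+m+n]*[x*-1^n]≡-1^[1+m]*x pairs⁺ pairs⁻ fixedProduct ⟩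
    -1ℤ ^ suc pairs⁺ * fixedProduct            ≡⟨ cong (λ t → -1ℤ ^ t * fixedProduct) exponent ⟨
    -1ℤ ^ ((mu p ℕ.+ 1) / 2) * fixedProduct    ∎
    where
    open import Relation.Binary.Reasoning.Setoid ≈-setoid
    P : ℕ
    P = pairs⁺ ℕ.+ pairs⁻
    h≡a+b : h ≡ (fixedCount ℕ.+ P) ℕ.+ suc P
    h≡a+b = trans h≡1+k (trans (cong suc k≡fixed+2pairs) (arithmetic fixedCount P))
      where
      arithmetic : ∀ f q → suc (f ℕ.+ (q ℕ.+ q)) ≡ (f ℕ.+ q) ℕ.+ suc q
      arithmetic = ℕ-solve-∀
    halves : suc P ≡ fixedCount ℕ.+ P ⊎ suc P ≡ suc (fixedCount ℕ.+ P)
    halves = Sum.swap (Sum.map (λ F≡0 → cong (λ f → suc (f ℕ.+ P)) (sym F≡0)) (λ F≡1 → cong (ℕ._+ P) (sym F≡1)) fixedCount≤1)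
    exponent : (mu p ℕ.+ 1) / 2 ≡ suc pairs⁺
    exponent = trans (cong (λ m → (m ℕ.+ 1) / 2) mu≡1+2pairs⁺) (trans (cong (_/ 2) (arithmetic pairs⁺)) (m*n/n≡m (suc pairs⁺) 2))
      where
      arithmetic : ∀ q → suc (q ℕ.+ q) ℕ.+ 1 ≡ suc q ℕ.* 2
      arithmetic = ℕ-solve-∀

  fixed-point⇒p%4≡1 : fixedCount ≡ 1 → p % 4 ≡ 1
  fixed-point⇒p%4≡1 F≡1 = trans (cong (_% 4) p≡1+4q) ([m+kn]%n≡m%n 1 (suc P) 4)
    where
    P : ℕ
    P = pairs⁺ ℕ.+ pairs⁻
    arithmetic : ∀ q → suc (suc (suc (q ℕ.+ q)) ℕ.+ suc (suc (q ℕ.+ q))) ≡ 1 ℕ.+ suc q ℕ.* 4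
    arithmetic = ℕ-solve-∀
    p≡1+4q : p ≡ 1 ℕ.+ suc P ℕ.* 4
    p≡1+4q = trans p≡1+2h (trans (cong (λ t → suc (t ℕ.+ t)) (trans h≡1+k (cong suc (trans k≡fixed+2pairs (cong (ℕ._+ (P ℕ.+ P)) F≡1)))))
               (arithmetic P))

  fixed-point-or-none : (∃ λ c → c ∈ [2,h] × σ c ≡ c) ⊎ (∀ {x} → x ∈ [2,h] → σ x ≢ x)
  fixed-point-or-none with any? (λ x → σ x ≟ x) [2,h]
  ... | yes has-fixed = inj₁ (find has-fixed)
  ... | no no-fixed = inj₂ λ x∈ σx≡x → no-fixed (lose x∈ σx≡x)

  !!≈sign-if-3mod4 : p % 4 ≡ 3 → + ((p ∸ 1) !!) ≈ -1ℤ ^ ((mu p ℕ.+ 1) / 2)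
  !!≈sign-if-3mod4 p%4≡3 = Sum.[ contradiction , no-fixed-point⇒ ]′ fixed-point-or-none
    where
    contradiction : (∃ λ c → c ∈ [2,h] × σ c ≡ c) → + ((p ∸ 1) !!) ≈ -1ℤ ^ ((mu p ℕ.+ 1) / 2)
    contradiction (c , c∈ , σc≡c) = ⊥-elim (1≢3 (trans (sym (fixed-point⇒p%4≡1 (proj₁ (one-fixed-point c∈ σc≡c)))) p%4≡3))
      where
      1≢3 : 1 ≢ 3
      1≢3 ()
    no-fixed-point⇒ : (∀ {x} → x ∈ [2,h] → σ x ≢ x) → + ((p ∸ 1) !!) ≈ -1ℤ ^ ((mu p ℕ.+ 1) / 2)
    no-fixed-point⇒ none = begin
      + ((p ∸ 1) !!)                           ≈⟨ !!≈sign*fixedProduct (inj₁ (proj₁ (no-fixed-point none))) ⟩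
      -1ℤ ^ ((mu p ℕ.+ 1) / 2) * fixedProduct  ≈⟨ *-cong (≈-refl { -1ℤ ^ ((mu p ℕ.+ 1) / 2)}) (proj₂ (no-fixed-point none)) ⟩
      -1ℤ ^ ((mu p ℕ.+ 1) / 2) * + 1           ≡⟨ ℤP.*-identityʳ (-1ℤ ^ ((mu p ℕ.+ 1) / 2)) ⟩
      -1ℤ ^ ((mu p ℕ.+ 1) / 2)                 ∎
      where open import Relation.Binary.Reasoning.Setoid ≈-setoid

  root-positive : ∀ {i} → + i * + i ≈ -1ℤ → 0 < i
  root-positive {zero} 0≈-1 = ⊥-elim (0≉1 (-‿cong 0≈-1))
  root-positive {suc _} _ = s≤s z≤n

  root≢1 : ∀ {i} → + i * + i ≈ -1ℤ → i ≢ 1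
  root≢1 1≈-1 refl = ⊥-elim (2≢0 (≈0⇒≡0 2<p (≈⇒-≈0 1≈-1)))
    where
    2≢0 : 2 ≢ 0
    2≢0 ()

  !!≈sign*root : ∀ {i} → 2 ℕ.* i < p → + i * + i ≈ -1ℤ → + ((p ∸ 1) !!) ≈ -1ℤ ^ ((mu p ℕ.+ 1) / 2) * + i
  !!≈sign*root {i} 2i<p i²≈-1 = begin
    + ((p ∸ 1) !!)                           ≈⟨ !!≈sign*fixedProduct (inj₂ (proj₁ i-fixed)) ⟩
    -1ℤ ^ ((mu p ℕ.+ 1) / 2) * fixedProduct  ≈⟨ *-cong (≈-refl { -1ℤ ^ ((mu p ℕ.+ 1) / 2)}) (proj₂ i-fixed) ⟩
    -1ℤ ^ ((mu p ℕ.+ 1) / 2) * + i           ∎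
    where
    open import Relation.Binary.Reasoning.Setoid ≈-setoid
    i-half : Half i
    i-half = root-positive i²≈-1 , 2i<p
    i-fixed : fixedCount ≡ 1 × fixedProduct ≈ + i
    i-fixed = one-fixed-point (half⇒∈[2,h] i-half (root≢1 i²≈-1)) (square≈-1⇒fixed i-half i²≈-1)

open import Data.Nat using (_*_)
open import Data.Nat.DivMod using (_/_)
open import Data.Integer using (_^_)
import Data.Nat
import Data.Integer

theorem5p2 : (p : ℕ) .{{_ : NonZero p}} → Prime p → p % 2 ≡ 1 →
    ((p % 4 ≡ 3 →
       (+ (((p Data.Nat.∸ 1) !!))) ≡ ((- (+ 1)) ^ ((mu p Data.Nat.+ 1) / 2)) [mod p ])
    × ((i : ℕ) → 2 * i < p → ((+ i) Data.Integer.* (+ i)) ≡ - (+ 1) [mod p ] → p % 4 ≡ 1 →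
       (+ (((p Data.Nat.∸ 1) !!))) ≡ ((- (+ 1)) ^ ((mu p Data.Nat.+ 1) / 2)) Data.Integer.* (+ i) [mod p ]))
theorem5p2 p p-prime p%2≡1 =
  (λ p%4≡3 → ≈⇒≡[mod] (!!≈sign-if-3mod4 p%4≡3)) ,
  (λ i 2i<p i²≡-1 _ → ≈⇒≡[mod] (!!≈sign*root 2i<p (≡[mod]⇒≈ i²≡-1)))
  where
  open Congruence p
  open DoubleFactorialModPrime p p-prime p%2≡1
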